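{- Let $m\ge 1$ and let $G$ be the graph which is the disjoint union of a cycle of length $3m$, with vertices $(0,t)$, $t\in\mathbb{Z}/3m\mathbb{Z}$, where $(0,t)$ is adjacent to $(0,t\pm1)$, and $m$ triangles, the $i$-th triangle ($i=1,\dots,m$) having vertices $(i,1),(i,2),(i,3)$ (second coordinate read modulo $3$). A position consists of one chip and $3m$ switches placed on vertices of $G$ such that each vertex holds at most one piece (either the chip or one switch) and, for every $i\in\{1,\dots,m\}$ and $j\in\{1,2,3\}$, exactly one of the vertices $(i,j)$ and $(0,3i+j-3)$ is occupied by a switch. A single move is one of: (Swap) if the chip is on one of the vertices $(i,j)$, $(0,3i+j-3)$ and a switch is on the other, the chip and that switch exchange places; (Jump) if the chip is on a vertex of the $i$-th triangle, it moves to any vacant vertex of the same triangle; if the chip is on $(0,t)$, it moves to $(0,t+1)$ or $(0,t-1)$ if that vertex is vacant. A sequence of single moves is legal if each move starts from the position in which the previous move ended. Let $P$ be a position in which the switches occupy exactly the vertices $(i,1)$, $(i,3)$, $(0,3i-1)$ for $i=1,\dots,m$, and the chip is on some vertex of the large cycle. For a sequence $\sigma$ of single moves, let $\#(\sigma,i_0,j_1,j_2)$ be the number of moves in $\sigma$ that are jumps of the chip from $(i_0,j_1)$ to $(i_0,j_2)$, and define the flow through $(i_0,j_0)$ as $$\mathcal{F}(\sigma,i_0,j_0)=\tfrac12\Big(\#(\sigma,i_0,j_0-1,j_0)+\#(\sigma,i_0,j_0,j_0+1)-\#(\sigma,i_0,j_0+1,j_0)-\#(\sigma,i_0,j_0,j_0-1)\Big),$$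 with the second coordinate taken modulo $3$ if $i_0\ge1$ and modulo $3m$ if $i_0=0$. If $\sigma$ is a legal sequence of single moves with initial position $P$ whose resulting position is again $P$, then $\mathcal{F}(\sigma,i,2)=\mathcal{F}(\sigma,0,3i-1)$ for every $i\in\{1,\dots,m\}$. -}

module Defs where

open import Data.Nat using (ℕ; zero; suc; _+_; _*_; _∸_; NonZero)
open import Data.Nat.Properties using (m*n≢0)
open import Data.Nat.DivMod using (_mod_)
open import Data.Fin as Fin using (Fin; toℕ)
open import Data.Fin.Properties using () renaming (_≟_ to _≟F_)
open import Data.Bool using (Bool; true; false; _∧_; if_then_else_)
open import Data.List using (List; []; _∷_)
open import Data.Integer using (ℤ; +_; _-_) renaming (_+_ to _+ℤ_)
open import Data.Product using (Σ; ∃; _×_; _,_)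
open import Data.Sum using (_⊎_)
open import Relation.Nullary using (¬_; Dec; yes; no; does)
open import Relation.Binary.PropositionalEquality using (_≡_; _≢_; refl; cong)

-- Conventions:
--  * cycle vertex (0,t), t ∈ ℤ/3mℤ, is  cyc t  with t : Fin (3 * m)
--    (the representative in {0,…,3m-1});
--  * triangle vertex (i,j), i ∈ {1..m}, j ∈ {1,2,3}, is  tri (i-1) (j-1)
--    with i-1 : Fin m and j-1 : Fin 3 (so j mod 3 becomes arithmetic mod 3
--    on Fin 3).

data Piece : Set where
  empty  : Piece
  chip   : Piece
  switch : Piece

module _ (m : ℕ) .{{_ : NonZero m}} where

  instance
    nz3m : NonZero (3 * m)
    nz3m = m*n≢0 3 m

  data Vertex : Set where
    cyc : Fin (3 * m) → Vertex
    tri : Fin m → Fin 3 → Vertex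

  cycIdx : ℕ → Fin (3 * m)
  cycIdx t = t mod (3 * m)

  cycV : ℕ → Vertex
  cycV t = cyc (cycIdx t)

  nextF : ∀ {n} .{{_ : NonZero n}} → Fin n → Fin n
  nextF {n} x = (toℕ x + 1) mod n

  prevF : ∀ {n} .{{_ : NonZero n}} → Fin n → Fin n
  prevF {n} x = (toℕ x + (n ∸ 1)) mod n

  -- partner of triangle vertex (i,j) is (0, 3i+j-3); with 0-based
  -- i' = i-1, j' = j-1 this is (0, 3i'+j'+1 mod 3m)
  partnerIdx : Fin m → Fin 3 → Fin (3 * m)
  partnerIdx i j = (3 * toℕ i + toℕ j + 1) mod (3 * m)

  data Partners : Vertex → Vertex → Set where
    tri→cyc : ∀ i j → Partners (tri i j) (cyc (partnerIdx i j))
    cyc→tri : ∀ i j → Partners (cyc (partnerIdx i j)) (tri i j)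

  Occ : Set
  Occ = Vertex → Piece

  ExactlyOne : Set → Set → Set
  ExactlyOne A B = (A × ¬ B) ⊎ (¬ A × B)

  record IsPosition (P : Occ) : Set where
    field
      chipAt   : Vertex
      chipHere : P chipAt ≡ chip
      chipOnly : ∀ v → P v ≡ chip → v ≡ chipAt
      switches : ∀ i j → ExactlyOne (P (tri i j) ≡ switch)
                                    (P (cyc (partnerIdx i j)) ≡ switch)

  data JumpAdj : Vertex → Vertex → Set where
    inTri   : ∀ i j k → j ≢ k → JumpAdj (tri i j) (tri i k)
    cycNext : ∀ t → JumpAdj (cyc t) (cyc (nextF t))
    cycPrev : ∀ t → JumpAdj (cyc t) (cyc (prevF t))

  data Move : Set where
    swapM : Vertex → Vertex → Move
    jumpM : Vertex → Vertex → Move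

  data Step (P : Occ) : Move → Occ → Set where
    swapS : ∀ {Q} v w → Partners v w → P v ≡ chip → P w ≡ switch →
            Q v ≡ switch → Q w ≡ chip →
            (∀ x → x ≢ v → x ≢ w → Q x ≡ P x) →
            Step P (swapM v w) Q
    jumpS : ∀ {Q} v w → JumpAdj v w → P v ≡ chip → P w ≡ empty →
            Q v ≡ empty → Q w ≡ chip →
            (∀ x → x ≢ v → x ≢ w → Q x ≡ P x) →
            Step P (jumpM v w) Q

  data Legal : Occ → List Move → Occ → Set where
    done : ∀ {P} → Legal P [] P
    step : ∀ {P Q R μ σ} → Step P μ Q → Legal Q σ R → Legal P (μ ∷ σ) R

  _≟V_ : (v w : Vertex) → Dec (v ≡ w)
  cyc s ≟V cyc t with s ≟F t
  ... | yes refl = yes refl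
  ... | no s≢t = no λ { refl → s≢t refl }
  cyc s ≟V tri i j = no λ ()
  tri i j ≟V cyc t = no λ ()
  tri i j ≟V tri k l with i ≟F k | j ≟F l
  ... | yes refl | yes refl = yes refl
  ... | no i≢k | _ = no λ { refl → i≢k refl }
  ... | _ | no j≢l = no λ { refl → j≢l refl }

  countJumps : List Move → Vertex → Vertex → ℕ
  countJumps [] v w = 0
  countJumps (swapM _ _ ∷ σ) v w = countJumps σ v w
  countJumps (jumpM a b ∷ σ) v w =
    if does (a ≟V v) ∧ does (b ≟V w)
    then suc (countJumps σ v w) else countJumps σ v w

  twiceFlowAt : List Move → Vertex → Vertex → Vertex → ℤ
  twiceFlowAt σ u⁻ u u⁺ =
    ((+ countJumps σ u⁻ u) +ℤ (+ countJumps σ u u⁺))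
      - (+ countJumps σ u⁺ u) - (+ countJumps σ u u⁻)

  twiceFlowTri : List Move → Fin m → Fin 3 → ℤ
  twiceFlowTri σ i j = twiceFlowAt σ (tri i (prevF j)) (tri i j) (tri i (nextF j))

  twiceFlowCyc : List Move → Fin (3 * m) → ℤ
  twiceFlowCyc σ t = twiceFlowAt σ (cyc (prevF t)) (cyc t) (cyc (nextF t))

  -- the switch set of P: (i,1), (i,3), (0,3i-1) for i = 1..m
  -- (0-based: tri i 0, tri i 2, cyc (3i'+2 mod 3m))
  data InitialSwitch : Vertex → Set where
    sw1 : ∀ i → InitialSwitch (tri i Fin.zero)
    sw3 : ∀ i → InitialSwitch (tri i (Fin.suc (Fin.suc Fin.zero)))
    swC : ∀ (i : Fin m) → InitialSwitch (cycV (3 * toℕ i + 2))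

module Submission where

-- Fix a triangle i and call its gadget the vertices T₀ = (i,1), A = (i,2), T₂ = (i,3)
-- together with their partners Bₘ, B, Bₚ, which are consecutive on the cycle.  We show
-- that the flow gap  2F(A) - 2F(B)  of a move sequence is the change of a potential:
-- while the chip stands on A or B the potential records which of T₀, T₂ carries a
-- switch (+1 for T₂, -1 for T₀), and otherwise it is 0.  This holds for every single move
-- from a position in which triangle i has exactly one vacant vertex, and both being a
-- position and having a single vacancy in a triangle are preserved by every move.
-- Summing over a legal sequence, the potential telescopes; in the initial position the
-- vacancy of triangle i is A, and a sequence returning to its start has zero gap.

open import Defs
open import Data.Nat using (ℕ; zero; suc; _+_; _*_; _∸_; NonZero; >-nonZero⁻¹)
open import Data.Nat.Properties using (m*n≢0; *-comm; +-assoc; +-comm; +-identityʳ; m∸n+n≡m)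
open import Data.Nat.DivMod using (_%_; _mod_; %-distribˡ-+; m%n%n≡m%n; [m+n]%n≡m%n; m<n⇒m%n≡m; m%n<n)
open import Data.Fin using (Fin; toℕ; zero; suc; combine; cast)
open import Data.Fin.Properties
  using (toℕ-injective; toℕ-fromℕ<; toℕ<n; toℕ-cast; toℕ-combine; combine-injectiveˡ; combine-injectiveʳ)
  renaming (_≟_ to _≟F_)
open import Data.List using (List; _∷_; [_])
open import Data.Integer using (ℤ; +_; 0ℤ; -1ℤ) renaming (_+_ to _+ℤ_; _-_ to _-ℤ_)
import Data.Integer.Properties as ℤ
open import Data.Integer.Tactic.RingSolver using (solve-∀)
open import Data.Bool using (true; false; _∧_)
open import Data.Product using (∃; _×_; _,_; proj₁; proj₂)
open import Data.Sum using (_⊎_; inj₁; inj₂)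
open import Data.Empty using (⊥-elim)
open import Relation.Nullary using (¬_; Dec; yes; no; does)
open import Relation.Binary.PropositionalEquality
  using (_≡_; _≢_; refl; sym; trans; cong; cong₂; ≢-sym; module ≡-Reasoning)

%-absorbˡ : ∀ a b n .{{_ : NonZero n}} → (a % n + b) % n ≡ (a + b) % n
%-absorbˡ a b n = begin
  (a % n + b) % n          ≡⟨ %-distribˡ-+ (a % n) b n ⟩
  (a % n % n + b % n) % n  ≡⟨ cong (λ z → (z + b % n) % n) (m%n%n≡m%n a n) ⟩
  (a % n + b % n) % n      ≡⟨ %-distribˡ-+ a b n ⟨
  (a + b) % n              ∎
  where open ≡-Reasoning

toℕ-mod : ∀ a n .{{_ : NonZero n}} → toℕ (a mod n) ≡ a % n
toℕ-mod a n = toℕ-fromℕ< (m%n<n a n)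

round-trip : ∀ {n} .{{_ : NonZero n}} (x : Fin n) a b → a + b ≡ n →
             (toℕ ((toℕ x + a) mod n) + b) mod n ≡ x
round-trip {n} x a b a+b≡n = toℕ-injective (begin
  toℕ ((toℕ ((toℕ x + a) mod n) + b) mod n)  ≡⟨ toℕ-mod _ n ⟩
  (toℕ ((toℕ x + a) mod n) + b) % n          ≡⟨ cong (λ z → (z + b) % n) (toℕ-mod _ n) ⟩
  ((toℕ x + a) % n + b) % n                  ≡⟨ %-absorbˡ (toℕ x + a) b n ⟩
  (toℕ x + a + b) % n                        ≡⟨ cong (_% n) (trans (+-assoc (toℕ x) a b) (cong (λ z → toℕ x + z) a+b≡n)) ⟩
  (toℕ x + n) % n                            ≡⟨ [m+n]%n≡m%n (toℕ x) n ⟩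
  toℕ x % n                                  ≡⟨ m<n⇒m%n≡m (toℕ<n x) ⟩
  toℕ x                                      ∎)
  where open ≡-Reasoning

n∸1+1≡n : ∀ n .{{_ : NonZero n}} → n ∸ 1 + 1 ≡ n
n∸1+1≡n n = m∸n+n≡m (>-nonZero⁻¹ n)

≢-by : ∀ {p q r : Piece} → p ≡ q → q ≢ r → p ≢ r
≢-by refl q≢r = q≢r

occupied-by-switch : ∀ {p} → p ≢ empty → p ≢ chip → p ≡ switch
occupied-by-switch {empty}  p≢empty _ = ⊥-elim (p≢empty refl)
occupied-by-switch {chip}   _ p≢chip  = ⊥-elim (p≢chip refl)
occupied-by-switch {switch} _ _       = refl

vacant : ∀ {p} → p ≢ switch → p ≢ chip → p ≡ empty
vacant {empty}  _ _        = refl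
vacant {chip}   _ p≢chip   = ⊥-elim (p≢chip refl)
vacant {switch} p≢switch _ = ⊥-elim (p≢switch refl)

switchValue : Piece → ℤ
switchValue switch = + 1
switchValue _      = 0ℤ

weight : Piece → Piece → Piece → Piece → ℤ
weight chip _    t₀ t₂ = switchValue t₂ -ℤ switchValue t₀
weight _    chip t₀ t₂ = switchValue t₂ -ℤ switchValue t₀
weight _    _    _  _  = 0ℤ

weight-idle : ∀ {a b t₀ t₂} → a ≢ chip → b ≢ chip → weight a b t₀ t₂ ≡ 0ℤ
weight-idle {chip}             a≢chip _      = ⊥-elim (a≢chip refl)
weight-idle {empty}  {chip}    _      b≢chip = ⊥-elim (b≢chip refl)
weight-idle {switch} {chip}    _      b≢chip = ⊥-elim (b≢chip refl)
weight-idle {empty}  {empty}   _      _      = refl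
weight-idle {empty}  {switch}  _      _      = refl
weight-idle {switch} {empty}   _      _      = refl
weight-idle {switch} {switch}  _      _      = refl

+-no-effect : ∀ p g → p +ℤ g ≡ p → g ≡ 0ℤ
+-no-effect p g eq = begin
  g                  ≡⟨ regroup p g ⟩
  (p +ℤ g) -ℤ p      ≡⟨ cong (_-ℤ p) eq ⟩
  p -ℤ p             ≡⟨ ℤ.+-inverseʳ p ⟩
  0ℤ                 ∎
  where
  open ≡-Reasoning
  regroup : ∀ (p g : ℤ) → g ≡ (p +ℤ g) -ℤ p
  regroup = solve-∀

module _ (m : ℕ) .{{_ : NonZero m}} where

  instance
    nonZero-3m : NonZero (3 * m)
    nonZero-3m = m*n≢0 3 m

  prev-next : ∀ {n} .{{_ : NonZero n}} (x : Fin n) → prevF m (nextF m x) ≡ x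
  prev-next {n} x = round-trip x 1 (n ∸ 1) (trans (+-comm 1 (n ∸ 1)) (n∸1+1≡n n))

  next-prev : ∀ {n} .{{_ : NonZero n}} (x : Fin n) → nextF m (prevF m x) ≡ x
  next-prev {n} x = round-trip x (n ∸ 1) 1 (n∸1+1≡n n)

  next-mod : ∀ {n} .{{_ : NonZero n}} a → nextF m (a mod n) ≡ (a + 1) mod n
  next-mod {n} a = toℕ-injective (begin
    toℕ (nextF m (a mod n))   ≡⟨ toℕ-mod _ n ⟩
    (toℕ (a mod n) + 1) % n   ≡⟨ cong (λ z → (z + 1) % n) (toℕ-mod a n) ⟩
    (a % n + 1) % n           ≡⟨ %-absorbˡ a 1 n ⟩
    (a + 1) % n               ≡⟨ toℕ-mod (a + 1) n ⟨
    toℕ ((a + 1) mod n)       ∎)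
    where open ≡-Reasoning

  slot : Fin m → Fin 3 → Fin (3 * m)
  slot k j = cast (*-comm m 3) (combine k j)

  partner-slot : ∀ k j → partnerIdx m k j ≡ nextF m (slot k j)
  partner-slot k j =
    cong (λ z → (z + 1) mod (3 * m)) (sym (trans (toℕ-cast _ (combine k j)) (toℕ-combine k j)))

  partner-injective : ∀ {k j k′ j′} → partnerIdx m k j ≡ partnerIdx m k′ j′ → k ≡ k′ × j ≡ j′
  partner-injective {k} {j} {k′} {j′} eq =
    combine-injectiveˡ k j k′ j′ same , combine-injectiveʳ k j k′ j′ same
    where
    same-slot : slot k j ≡ slot k′ j′
    same-slot = begin
      slot k j                    ≡⟨ prev-next (slot k j) ⟨
      prevF m (nextF m (slot k j))   ≡⟨ cong (prevF m) (trans (sym (partner-slot k j)) (trans eq (partner-slot k′ j′))) ⟩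
      prevF m (nextF m (slot k′ j′)) ≡⟨ prev-next (slot k′ j′) ⟩
      slot k′ j′                  ∎
      where open ≡-Reasoning
    same : combine k j ≡ combine k′ j′
    same = toℕ-injective (trans (sym (toℕ-cast _ (combine k j)))
                           (trans (cong toℕ same-slot) (toℕ-cast _ (combine k′ j′))))

  next-partner₀ : ∀ k → nextF m (partnerIdx m k zero) ≡ partnerIdx m k (suc zero)
  next-partner₀ k = trans (next-mod _) (cong (λ z → (z + 1 + 1) mod (3 * m)) (+-identityʳ (3 * toℕ k)))

  next-partner₁ : ∀ k → nextF m (partnerIdx m k (suc zero)) ≡ partnerIdx m k (suc (suc zero))
  next-partner₁ k = trans (next-mod _) (cong (λ z → (z + 1) mod (3 * m)) (+-assoc (3 * toℕ k) 1 1))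

  prev-partner₁ : ∀ k → prevF m (partnerIdx m k (suc zero)) ≡ partnerIdx m k zero
  prev-partner₁ k = trans (cong (prevF m) (sym (next-partner₀ k))) (prev-next _)

  prev-partner₂ : ∀ k → prevF m (partnerIdx m k (suc (suc zero))) ≡ partnerIdx m k (suc zero)
  prev-partner₂ k = trans (cong (prevF m) (sym (next-partner₁ k))) (prev-next _)

  tri-injective : ∀ {k j k′ j′} → tri {m} k j ≡ tri k′ j′ → k ≡ k′ × j ≡ j′
  tri-injective refl = refl , refl

  cyc-injective : ∀ {s t} → cyc {m} s ≡ cyc t → s ≡ t
  cyc-injective refl = refl

  partner-vertex-injective : ∀ k j k′ j′ →
    cyc {m} (partnerIdx m k j) ≡ cyc (partnerIdx m k′ j′) → tri {m} k j ≡ tri k′ j′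
  partner-vertex-injective k j k′ j′ eq with partner-injective {k} {j} {k′} {j′} (cyc-injective eq)
  ... | refl , refl = refl

  _≟_ : (v w : Vertex m) → Dec (v ≡ w)
  _≟_ = _≟V_ m

  count-hit : ∀ v w → countJumps m [ jumpM v w ] v w ≡ 1
  count-hit v w with v ≟ v | w ≟ w
  ... | yes _ | yes _ = refl
  ... | no v≢v | _ = ⊥-elim (v≢v refl)
  ... | yes _ | no w≢w = ⊥-elim (w≢w refl)

  count-miss : ∀ v w x y → v ≢ x ⊎ w ≢ y → countJumps m [ jumpM v w ] x y ≡ 0
  count-miss v w x y differ with v ≟ x | w ≟ y
  ... | yes _ | no _ = refl
  ... | no _ | _ = refl
  ... | yes v≡x | yes w≡y with differ
  ...   | inj₁ v≢x = ⊥-elim (v≢x v≡x)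
  ...   | inj₂ w≢y = ⊥-elim (w≢y w≡y)

  count-cons : ∀ μ σ x y → countJumps m (μ ∷ σ) x y ≡ countJumps m [ μ ] x y + countJumps m σ x y
  count-cons (swapM _ _) σ x y = refl
  count-cons (jumpM v w) σ x y with does (v ≟ x) ∧ does (w ≟ y)
  ... | true = refl
  ... | false = refl

  twiceFlow-cons : ∀ μ σ u⁻ u u⁺ →
    twiceFlowAt m (μ ∷ σ) u⁻ u u⁺ ≡ twiceFlowAt m [ μ ] u⁻ u u⁺ +ℤ twiceFlowAt m σ u⁻ u u⁺
  twiceFlow-cons μ σ u⁻ u u⁺
    rewrite count-cons μ σ u⁻ u | count-cons μ σ u u⁺ | count-cons μ σ u⁺ u | count-cons μ σ u u⁻
    = flux-additive (countJumps m [ μ ] u⁻ u) (countJumps m [ μ ] u u⁺) (countJumps m [ μ ] u⁺ u)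
                    (countJumps m [ μ ] u u⁻) (countJumps m σ u⁻ u) (countJumps m σ u u⁺)
                    (countJumps m σ u⁺ u) (countJumps m σ u u⁻)
    where
    regroup : ∀ (a b c d a′ b′ c′ d′ : ℤ) →
      ((a +ℤ a′) +ℤ (b +ℤ b′)) -ℤ (c +ℤ c′) -ℤ (d +ℤ d′) ≡
      ((a +ℤ b) -ℤ c -ℤ d) +ℤ ((a′ +ℤ b′) -ℤ c′ -ℤ d′)
    regroup = solve-∀
    flux-additive : ∀ a b c d a′ b′ c′ d′ →
      ((+ (a + a′)) +ℤ (+ (b + b′))) -ℤ (+ (c + c′)) -ℤ (+ (d + d′)) ≡
      (((+ a) +ℤ (+ b)) -ℤ (+ c) -ℤ (+ d)) +ℤ (((+ a′) +ℤ (+ b′)) -ℤ (+ c′) -ℤ (+ d′))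
    flux-additive a b c d a′ b′ c′ d′
      rewrite ℤ.pos-+ a a′ | ℤ.pos-+ b b′ | ℤ.pos-+ c c′ | ℤ.pos-+ d d′
      = regroup (+ a) (+ b) (+ c) (+ d) (+ a′) (+ b′) (+ c′) (+ d′)

  twiceFlow-counts : ∀ σ u⁻ u u⁺ {a b c d} →
    countJumps m σ u⁻ u ≡ a → countJumps m σ u u⁺ ≡ b →
    countJumps m σ u⁺ u ≡ c → countJumps m σ u u⁻ ≡ d →
    twiceFlowAt m σ u⁻ u u⁺ ≡ ((+ a) +ℤ (+ b)) -ℤ (+ c) -ℤ (+ d)
  twiceFlow-counts σ u⁻ u u⁺ refl refl refl refl = refl

  Distinct₃ : Vertex m → Vertex m → Vertex m → Set
  Distinct₃ u⁻ u u⁺ = u⁻ ≢ u × u ≢ u⁺ × u⁻ ≢ u⁺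

  flow-avoid : ∀ u⁻ u u⁺ v w → v ≢ u → w ≢ u → twiceFlowAt m [ jumpM v w ] u⁻ u u⁺ ≡ 0ℤ
  flow-avoid u⁻ u u⁺ v w v≢u w≢u =
    twiceFlow-counts [ jumpM v w ] u⁻ u u⁺
      (count-miss v w u⁻ u (inj₂ w≢u)) (count-miss v w u u⁺ (inj₁ v≢u))
      (count-miss v w u⁺ u (inj₂ w≢u)) (count-miss v w u u⁻ (inj₁ v≢u))

  flow-enter : ∀ {u⁻ u u⁺} → Distinct₃ u⁻ u u⁺ → twiceFlowAt m [ jumpM u⁻ u ] u⁻ u u⁺ ≡ + 1
  flow-enter {u⁻} {u} {u⁺} (d₁ , d₂ , d₃) =
    twiceFlow-counts [ jumpM u⁻ u ] u⁻ u u⁺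
      (count-hit u⁻ u) (count-miss u⁻ u u u⁺ (inj₁ d₁))
      (count-miss u⁻ u u⁺ u (inj₁ d₃)) (count-miss u⁻ u u u⁻ (inj₁ d₁))

  flow-exit : ∀ {u⁻ u u⁺} → Distinct₃ u⁻ u u⁺ → twiceFlowAt m [ jumpM u u⁺ ] u⁻ u u⁺ ≡ + 1
  flow-exit {u⁻} {u} {u⁺} (d₁ , d₂ , d₃) =
    twiceFlow-counts [ jumpM u u⁺ ] u⁻ u u⁺
      (count-miss u u⁺ u⁻ u (inj₁ (≢-sym d₁))) (count-hit u u⁺)
      (count-miss u u⁺ u⁺ u (inj₁ d₂)) (count-miss u u⁺ u u⁻ (inj₂ (≢-sym d₃)))

  flow-back-enter : ∀ {u⁻ u u⁺} → Distinct₃ u⁻ u u⁺ → twiceFlowAt m [ jumpM u⁺ u ] u⁻ u u⁺ ≡ -1ℤ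
  flow-back-enter {u⁻} {u} {u⁺} (d₁ , d₂ , d₃) =
    twiceFlow-counts [ jumpM u⁺ u ] u⁻ u u⁺
      (count-miss u⁺ u u⁻ u (inj₁ (≢-sym d₃))) (count-miss u⁺ u u u⁺ (inj₁ (≢-sym d₂)))
      (count-hit u⁺ u) (count-miss u⁺ u u u⁻ (inj₁ (≢-sym d₂)))

  flow-back-exit : ∀ {u⁻ u u⁺} → Distinct₃ u⁻ u u⁺ → twiceFlowAt m [ jumpM u u⁻ ] u⁻ u u⁺ ≡ -1ℤ
  flow-back-exit {u⁻} {u} {u⁺} (d₁ , d₂ , d₃) =
    twiceFlow-counts [ jumpM u u⁻ ] u⁻ u u⁺
      (count-miss u u⁻ u⁻ u (inj₁ (≢-sym d₁))) (count-miss u u⁻ u u⁺ (inj₂ d₃))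
      (count-miss u u⁻ u⁺ u (inj₁ d₂)) (count-hit u u⁻)

  Unchanged : Occ m → Occ m → Vertex m → Vertex m → Set
  Unchanged P Q v w = ∀ x → x ≢ v → x ≢ w → Q x ≡ P x

  SwitchCondition : Occ m → Set
  SwitchCondition Q = ∀ k j → ExactlyOne m (Q (tri k j) ≡ switch) (Q (cyc (partnerIdx m k j)) ≡ switch)

  SamePlaces : Piece → Occ m → Occ m → Set
  SamePlaces p P Q = ∀ x → (P x ≡ p → Q x ≡ p) × (Q x ≡ p → P x ≡ p)

  untouched-piece : ∀ p {P Q v w} → P v ≢ p → P w ≢ p → Q v ≢ p → Q w ≢ p →
                    Unchanged P Q v w → SamePlaces p P Q
  untouched-piece p {v = v} {w} pv pw qv qw fr x with x ≟ v | x ≟ w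
  ... | yes refl | _ = (λ e → ⊥-elim (pv e)) , (λ e → ⊥-elim (qv e))
  ... | no _ | yes refl = (λ e → ⊥-elim (pw e)) , (λ e → ⊥-elim (qw e))
  ... | no x≢v | no x≢w = (λ e → trans (fr x x≢v x≢w) e) , (λ e → trans (sym (fr x x≢v x≢w)) e)

  chip-unique : ∀ {P x y} → IsPosition m P → P x ≡ chip → P y ≡ chip → x ≡ y
  chip-unique pos px py = trans (chipOnly _ px) (sym (chipOnly _ py))
    where open IsPosition pos

  chip-relocated : ∀ {P Q v w} → IsPosition m P → P v ≡ chip → Q v ≢ chip → Q w ≡ chip →
                   Unchanged P Q v w → ∀ x → Q x ≡ chip → x ≡ w
  chip-relocated {v = v} {w} pos pv qv qw fr x qx with x ≟ w
  ... | yes x≡w = x≡w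
  ... | no x≢w with x ≟ v
  ...   | yes refl = ⊥-elim (qv qx)
  ...   | no x≢v = ⊥-elim (x≢v (chip-unique pos (trans (sym (fr x x≢v x≢w)) qx) pv))

  exactlyOne-comm : ∀ {X Y : Set} → ExactlyOne m X Y → ExactlyOne m Y X
  exactlyOne-comm (inj₁ (x , ¬y)) = inj₂ (¬y , x)
  exactlyOne-comm (inj₂ (¬x , y)) = inj₁ (y , ¬x)

  swap-switches : ∀ {P Q k j} → SwitchCondition P →
                  Q (tri k j) ≡ P (cyc (partnerIdx m k j)) → Q (cyc (partnerIdx m k j)) ≡ P (tri k j) →
                  Unchanged P Q (tri k j) (cyc (partnerIdx m k j)) → SwitchCondition Q
  swap-switches {k = k} {j} sw qX qY fr k′ j′ with tri k′ j′ ≟ tri k j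
  ... | yes refl rewrite qX | qY = exactlyOne-comm (sw k j)
  ... | no other
    rewrite fr (tri k′ j′) other (λ ())
          | fr (cyc (partnerIdx m k′ j′)) (λ ()) (λ e → other (partner-vertex-injective k′ j′ k j e))
    = sw k′ j′

  fixed-switches : ∀ {P Q} → SamePlaces switch P Q → SwitchCondition P → SwitchCondition Q
  fixed-switches same sw k j with sw k j
  ... | inj₁ (s , ¬s′) = inj₁ (proj₁ (same _) s , λ s′ → ¬s′ (proj₂ (same _) s′))
  ... | inj₂ (¬s , s′) = inj₂ ((λ s → ¬s (proj₂ (same _) s)) , proj₁ (same _) s′)

  step-position : ∀ {P μ Q} → IsPosition m P → Step m P μ Q → IsPosition m Q
  step-position pos (swapS _ w pair pv pw qv qw fr) = record
    { chipAt = w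
    ; chipHere = qw
    ; chipOnly = chip-relocated pos pv (≢-by qv (λ ())) qw fr
    ; switches = pair-switches pair (IsPosition.switches pos) pv pw qv qw fr
    }
    where
    pair-switches : ∀ {P Q v w} → Partners m v w → SwitchCondition P → P v ≡ chip → P w ≡ switch →
                    Q v ≡ switch → Q w ≡ chip → Unchanged P Q v w → SwitchCondition Q
    pair-switches (tri→cyc k j) sw pv pw qv qw fr =
      swap-switches sw (trans qv (sym pw)) (trans qw (sym pv)) fr
    pair-switches (cyc→tri k j) sw pv pw qv qw fr =
      swap-switches sw (trans qw (sym pv)) (trans qv (sym pw)) (λ x a b → fr x b a)
  step-position pos (jumpS _ w _ pv pw qv qw fr) = record
    { chipAt = w
    ; chipHere = qw
    ; chipOnly = chip-relocated pos pv (≢-by qv (λ ())) qw fr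
    ; switches = fixed-switches
        (untouched-piece switch (≢-by pv (λ ())) (≢-by pw (λ ())) (≢-by qv (λ ())) (≢-by qw (λ ())) fr)
        (IsPosition.switches pos)
    }

  record SingleVacancy (Q : Occ m) (k : Fin m) : Set where
    constructor vacancy-at
    field
      hole      : Fin 3
      hole-free : Q (tri k hole) ≡ empty
      only-hole : ∀ l → Q (tri k l) ≡ empty → l ≡ hole

  vacancy-unique : ∀ {P k a b} → SingleVacancy P k → P (tri k a) ≡ empty → P (tri k b) ≡ empty → a ≡ b
  vacancy-unique (vacancy-at _ _ only) ea eb = trans (only _ ea) (sym (only _ eb))

  remaining-switch : ∀ {P k a b c} → IsPosition m P → SingleVacancy P k →
                     P (tri k a) ≡ chip → P (tri k b) ≡ empty → c ≢ a → c ≢ b → P (tri k c) ≡ switch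
  remaining-switch pos vac pa pb c≢a c≢b =
    occupied-by-switch (λ e → c≢b (vacancy-unique vac e pb))
                       (λ e → c≢a (proj₂ (tri-injective (chip-unique pos e pa))))

  vacancy-transfer : ∀ {P Q k} →
    (∀ l → (P (tri k l) ≡ empty → Q (tri k l) ≡ empty) × (Q (tri k l) ≡ empty → P (tri k l) ≡ empty)) →
    SingleVacancy P k → SingleVacancy Q k
  vacancy-transfer same (vacancy-at h ph only) =
    vacancy-at h (proj₁ (same h) ph) (λ l e → only l (proj₂ (same l) e))

  vacancy-untouched : ∀ {P Q k} → (∀ l → Q (tri k l) ≡ P (tri k l)) → SingleVacancy P k → SingleVacancy Q k
  vacancy-untouched eq = vacancy-transfer (λ l → (λ e → trans (eq l) e) , (λ e → trans (sym (eq l)) e))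

  vacancy-moves : ∀ {P Q k j l} → P (tri k j) ≡ chip → P (tri k l) ≡ empty →
                  Q (tri k j) ≡ empty → Q (tri k l) ≡ chip → Unchanged P Q (tri k j) (tri k l) →
                  SingleVacancy P k → SingleVacancy Q k
  vacancy-moves {Q = Q} {k} {j} {l} pv pw qv qw fr vac = vacancy-at j qv only
    where
    only : ∀ l′ → Q (tri k l′) ≡ empty → l′ ≡ j
    only l′ e with l′ ≟F j | l′ ≟F l
    ... | yes l′≡j | _ = l′≡j
    ... | no _ | yes refl = ⊥-elim (≢-by qw (λ ()) e)
    ... | no l′≢j | no l′≢l =
      ⊥-elim (l′≢l (vacancy-unique vac (trans (sym (fr (tri k l′) (apart l′≢j) (apart l′≢l))) e) pw))
      where
      apart : ∀ {a b} → a ≢ b → tri {m} k a ≢ tri k b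
      apart a≢b e = a≢b (proj₂ (tri-injective e))

  step-vacancy : ∀ {P μ Q k} → Step m P μ Q → SingleVacancy P k → SingleVacancy Q k
  step-vacancy {k = k} (swapS _ _ _ pv pw qv qw fr) =
    vacancy-transfer (λ l → untouched-piece empty (≢-by pv (λ ())) (≢-by pw (λ ()))
                                                 (≢-by qv (λ ())) (≢-by qw (λ ())) fr (tri k l))
  step-vacancy {k = k} (jumpS _ _ (inTri k′ j l _) pv pw qv qw fr) with k′ ≟F k
  ... | yes refl = vacancy-moves pv pw qv qw fr
  ... | no k′≢k = vacancy-untouched (λ l′ → fr (tri k l′) (other-triangle j l′) (other-triangle l l′))
    where
    other-triangle : ∀ a b → tri {m} k b ≢ tri k′ a
    other-triangle a b e = k′≢k (sym (proj₁ (tri-injective e)))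
  step-vacancy (jumpS _ _ (cycNext _) _ _ _ _ fr) = vacancy-untouched (λ l → fr _ (λ ()) (λ ()))
  step-vacancy (jumpS _ _ (cycPrev _) _ _ _ _ fr) = vacancy-untouched (λ l → fr _ (λ ()) (λ ()))

  partner-switch : ∀ {P k j} → IsPosition m P → P (tri k j) ≢ switch → P (cyc (partnerIdx m k j)) ≡ switch
  partner-switch {k = k} {j} pos ¬s with IsPosition.switches pos k j
  ... | inj₁ (s , _) = ⊥-elim (¬s s)
  ... | inj₂ (_ , s′) = s′

  triangle-switch : ∀ {P k j} → IsPosition m P → P (cyc (partnerIdx m k j)) ≢ switch → P (tri k j) ≡ switch
  triangle-switch {k = k} {j} pos ¬s′ with IsPosition.switches pos k j
  ... | inj₁ (s , _) = s
  ... | inj₂ (_ , s′) = ⊥-elim (¬s′ s′)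

  module Gadget (i : Fin m) where

    T₀ A T₂ Bₘ B Bₚ : Vertex m
    T₀ = tri i zero
    A  = tri i (suc zero)
    T₂ = tri i (suc (suc zero))
    Bₘ = cyc (partnerIdx m i zero)
    B  = cyc (partnerIdx m i (suc zero))
    Bₚ = cyc (partnerIdx m i (suc (suc zero)))

    potential : Occ m → ℤ
    potential Q = weight (Q A) (Q B) (Q T₀) (Q T₂)

    flowGap : List (Move m) → ℤ
    flowGap σ = twiceFlowAt m σ T₀ A T₂ -ℤ twiceFlowAt m σ Bₘ B Bₚ

    flowGap-cons : ∀ μ σ → flowGap (μ ∷ σ) ≡ flowGap [ μ ] +ℤ flowGap σ
    flowGap-cons μ σ
      rewrite twiceFlow-cons μ σ T₀ A T₂ | twiceFlow-cons μ σ Bₘ B Bₚ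
      = regroup (twiceFlowAt m [ μ ] T₀ A T₂) (twiceFlowAt m σ T₀ A T₂)
                (twiceFlowAt m [ μ ] Bₘ B Bₚ) (twiceFlowAt m σ Bₘ B Bₚ)
      where
      regroup : ∀ (a a′ b b′ : ℤ) → (a +ℤ a′) -ℤ (b +ℤ b′) ≡ (a -ℤ b) +ℤ (a′ -ℤ b′)
      regroup = solve-∀

    record Balanced (P : Occ m) (μ : Move m) (Q : Occ m) : Set where
      constructor balanced
      field change : potential P +ℤ flowGap [ μ ] ≡ potential Q

    by-pieces : ∀ {P Q} μ {a b t₀ t₂ a′ b′ t₀′ t₂′ g} →
      P A ≡ a → P B ≡ b → P T₀ ≡ t₀ → P T₂ ≡ t₂ →
      Q A ≡ a′ → Q B ≡ b′ → Q T₀ ≡ t₀′ → Q T₂ ≡ t₂′ →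
      flowGap [ μ ] ≡ g → weight a b t₀ t₂ +ℤ g ≡ weight a′ b′ t₀′ t₂′ → Balanced P μ Q
    by-pieces μ refl refl refl refl refl refl refl refl refl balance = balanced balance

    gap-of : ∀ μ {a b} → twiceFlowAt m [ μ ] T₀ A T₂ ≡ a → twiceFlowAt m [ μ ] Bₘ B Bₚ ≡ b →
             flowGap [ μ ] ≡ a -ℤ b
    gap-of μ = cong₂ _-ℤ_

    triangle-distinct : Distinct₃ T₀ A T₂
    triangle-distinct = (λ ()) , (λ ()) , (λ ())

    cycle-distinct : Distinct₃ Bₘ B Bₚ
    cycle-distinct = apart₀₁ , apart₁₂ , apart₀₂
      where
      apart₀₁ : Bₘ ≢ B
      apart₀₁ e with partner-vertex-injective i zero i (suc zero) e
      ... | ()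
      apart₁₂ : B ≢ Bₚ
      apart₁₂ e with partner-vertex-injective i (suc zero) i (suc (suc zero)) e
      ... | ()
      apart₀₂ : Bₘ ≢ Bₚ
      apart₀₂ e with partner-vertex-injective i zero i (suc (suc zero)) e
      ... | ()

    Away : Vertex m → Set
    Away v = v ≢ A × v ≢ B

    idle-potential : ∀ {P v} → IsPosition m P → P v ≡ chip → Away v → potential P ≡ 0ℤ
    idle-potential pos pv (v≢A , v≢B) =
      weight-idle (λ e → v≢A (chip-unique pos pv e)) (λ e → v≢B (chip-unique pos pv e))

    idle-balanced : ∀ {P μ Q v w} → IsPosition m P → IsPosition m Q → P v ≡ chip → Q w ≡ chip →
                    Away v → Away w → flowGap [ μ ] ≡ 0ℤ → Balanced P μ Q
    idle-balanced posP posQ pv qw away-v away-w gap =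
      balanced (trans (cong₂ _+ℤ_ (idle-potential posP pv away-v) gap) (sym (idle-potential posQ qw away-w)))

    idle-jump : ∀ {P Q v w} → IsPosition m P → IsPosition m Q → Away v → Away w →
                Step m P (jumpM v w) Q → Balanced P (jumpM v w) Q
    idle-jump {v = v} {w} posP posQ away-v@(v≢A , v≢B) away-w@(w≢A , w≢B) (jumpS _ _ _ pv _ _ qw _) =
      idle-balanced posP posQ pv qw away-v away-w
        (gap-of (jumpM v w) (flow-avoid T₀ A T₂ v w v≢A w≢A) (flow-avoid Bₘ B Bₚ v w v≢B w≢B))

    -- Jumps through the entrance A of the triangle.  The vacancy is the target, so the
    -- third triangle vertex holds a switch, and B holds the switch of the pair A, B.

    T₀→A : ∀ {P Q} → IsPosition m P → SingleVacancy P i → Step m P (jumpM T₀ A) Q → Balanced P (jumpM T₀ A) Q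
    T₀→A {P} pos vac (jumpS _ _ _ p₀ pA q₀ qA fr) =
      by-pieces (jumpM T₀ A) pA pB p₀ p₂ qA (trans (fr B (λ ()) (λ ())) pB) q₀ (trans (fr T₂ (λ ()) (λ ())) p₂)
        (gap-of (jumpM T₀ A) (flow-enter triangle-distinct) (flow-avoid Bₘ B Bₚ T₀ A (λ ()) (λ ()))) refl
      where
      pB : P B ≡ switch
      pB = partner-switch pos (≢-by pA (λ ()))
      p₂ : P T₂ ≡ switch
      p₂ = remaining-switch pos vac p₀ pA (λ ()) (λ ())

    A→T₂ : ∀ {P Q} → IsPosition m P → SingleVacancy P i → Step m P (jumpM A T₂) Q → Balanced P (jumpM A T₂) Q
    A→T₂ {P} pos vac (jumpS _ _ _ pA p₂ qA q₂ fr) =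
      by-pieces (jumpM A T₂) pA pB p₀ p₂ qA (trans (fr B (λ ()) (λ ())) pB) (trans (fr T₀ (λ ()) (λ ())) p₀) q₂
        (gap-of (jumpM A T₂) (flow-exit triangle-distinct) (flow-avoid Bₘ B Bₚ A T₂ (λ ()) (λ ()))) refl
      where
      pB : P B ≡ switch
      pB = partner-switch pos (≢-by pA (λ ()))
      p₀ : P T₀ ≡ switch
      p₀ = remaining-switch pos vac pA p₂ (λ ()) (λ ())

    T₂→A : ∀ {P Q} → IsPosition m P → SingleVacancy P i → Step m P (jumpM T₂ A) Q → Balanced P (jumpM T₂ A) Q
    T₂→A {P} pos vac (jumpS _ _ _ p₂ pA q₂ qA fr) =
      by-pieces (jumpM T₂ A) pA pB p₀ p₂ qA (trans (fr B (λ ()) (λ ())) pB) (trans (fr T₀ (λ ()) (λ ())) p₀) q₂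
        (gap-of (jumpM T₂ A) (flow-back-enter triangle-distinct) (flow-avoid Bₘ B Bₚ T₂ A (λ ()) (λ ()))) refl
      where
      pB : P B ≡ switch
      pB = partner-switch pos (≢-by pA (λ ()))
      p₀ : P T₀ ≡ switch
      p₀ = remaining-switch pos vac p₂ pA (λ ()) (λ ())

    A→T₀ : ∀ {P Q} → IsPosition m P → SingleVacancy P i → Step m P (jumpM A T₀) Q → Balanced P (jumpM A T₀) Q
    A→T₀ {P} pos vac (jumpS _ _ _ pA p₀ qA q₀ fr) =
      by-pieces (jumpM A T₀) pA pB p₀ p₂ qA (trans (fr B (λ ()) (λ ())) pB) q₀ (trans (fr T₂ (λ ()) (λ ())) p₂)
        (gap-of (jumpM A T₀) (flow-back-exit triangle-distinct) (flow-avoid Bₘ B Bₚ A T₀ (λ ()) (λ ()))) refl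
      where
      pB : P B ≡ switch
      pB = partner-switch pos (≢-by pA (λ ()))
      p₂ : P T₂ ≡ switch
      p₂ = remaining-switch pos vac pA p₀ (λ ()) (λ ())

    -- Jumps through the entrance B on the cycle.  Then A holds the switch of the pair A, B;
    -- the pair of the other cycle vertex involved fixes one of T₀, T₂, and the vacancy is the other.

    T₂-vacant : ∀ {P} → SingleVacancy P i → P T₀ ≡ switch → P A ≡ switch → P T₂ ≡ empty
    T₂-vacant (vacancy-at zero e _)             s₀ _  = ⊥-elim (≢-by s₀ (λ ()) e)
    T₂-vacant (vacancy-at (suc zero) e _)       _  sA = ⊥-elim (≢-by sA (λ ()) e)
    T₂-vacant (vacancy-at (suc (suc zero)) e _) _  _  = e

    T₀-vacant : ∀ {P} → SingleVacancy P i → P A ≡ switch → P T₂ ≡ switch → P T₀ ≡ empty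
    T₀-vacant (vacancy-at zero e _)             _  _  = e
    T₀-vacant (vacancy-at (suc zero) e _)       sA _  = ⊥-elim (≢-by sA (λ ()) e)
    T₀-vacant (vacancy-at (suc (suc zero)) e _) _  s₂ = ⊥-elim (≢-by s₂ (λ ()) e)

    Bₘ→B : ∀ {P Q} → IsPosition m P → SingleVacancy P i → Step m P (jumpM Bₘ B) Q → Balanced P (jumpM Bₘ B) Q
    Bₘ→B {P} pos vac (jumpS _ _ _ pBₘ pB qBₘ qB fr) =
      by-pieces (jumpM Bₘ B) pA pB p₀ p₂ (trans (fr A (λ ()) (λ ())) pA) qB
                (trans (fr T₀ (λ ()) (λ ())) p₀) (trans (fr T₂ (λ ()) (λ ())) p₂)
        (gap-of (jumpM Bₘ B) (flow-avoid T₀ A T₂ Bₘ B (λ ()) (λ ())) (flow-enter cycle-distinct)) refl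
      where
      pA : P A ≡ switch
      pA = triangle-switch pos (≢-by pB (λ ()))
      p₀ : P T₀ ≡ switch
      p₀ = triangle-switch pos (≢-by pBₘ (λ ()))
      p₂ : P T₂ ≡ empty
      p₂ = T₂-vacant vac p₀ pA

    B→Bₚ : ∀ {P Q} → IsPosition m P → SingleVacancy P i → Step m P (jumpM B Bₚ) Q → Balanced P (jumpM B Bₚ) Q
    B→Bₚ {P} pos vac (jumpS _ _ _ pB pBₚ qB qBₚ fr) =
      by-pieces (jumpM B Bₚ) pA pB p₀ p₂ (trans (fr A (λ ()) (λ ())) pA) qB
                (trans (fr T₀ (λ ()) (λ ())) p₀) (trans (fr T₂ (λ ()) (λ ())) p₂)
        (gap-of (jumpM B Bₚ) (flow-avoid T₀ A T₂ B Bₚ (λ ()) (λ ())) (flow-exit cycle-distinct)) refl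
      where
      pA : P A ≡ switch
      pA = triangle-switch pos (≢-by pB (λ ()))
      p₂ : P T₂ ≡ switch
      p₂ = triangle-switch pos (≢-by pBₚ (λ ()))
      p₀ : P T₀ ≡ empty
      p₀ = T₀-vacant vac pA p₂

    Bₚ→B : ∀ {P Q} → IsPosition m P → SingleVacancy P i → Step m P (jumpM Bₚ B) Q → Balanced P (jumpM Bₚ B) Q
    Bₚ→B {P} pos vac (jumpS _ _ _ pBₚ pB qBₚ qB fr) =
      by-pieces (jumpM Bₚ B) pA pB p₀ p₂ (trans (fr A (λ ()) (λ ())) pA) qB
                (trans (fr T₀ (λ ()) (λ ())) p₀) (trans (fr T₂ (λ ()) (λ ())) p₂)
        (gap-of (jumpM Bₚ B) (flow-avoid T₀ A T₂ Bₚ B (λ ()) (λ ())) (flow-back-enter cycle-distinct)) refl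
      where
      pA : P A ≡ switch
      pA = triangle-switch pos (≢-by pB (λ ()))
      p₂ : P T₂ ≡ switch
      p₂ = triangle-switch pos (≢-by pBₚ (λ ()))
      p₀ : P T₀ ≡ empty
      p₀ = T₀-vacant vac pA p₂

    B→Bₘ : ∀ {P Q} → IsPosition m P → SingleVacancy P i → Step m P (jumpM B Bₘ) Q → Balanced P (jumpM B Bₘ) Q
    B→Bₘ {P} pos vac (jumpS _ _ _ pB pBₘ qB qBₘ fr) =
      by-pieces (jumpM B Bₘ) pA pB p₀ p₂ (trans (fr A (λ ()) (λ ())) pA) qB
                (trans (fr T₀ (λ ()) (λ ())) p₀) (trans (fr T₂ (λ ()) (λ ())) p₂)
        (gap-of (jumpM B Bₘ) (flow-avoid T₀ A T₂ B Bₘ (λ ()) (λ ())) (flow-back-exit cycle-distinct)) refl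
      where
      pA : P A ≡ switch
      pA = triangle-switch pos (≢-by pB (λ ()))
      p₀ : P T₀ ≡ switch
      p₀ = triangle-switch pos (≢-by pBₘ (λ ()))
      p₂ : P T₂ ≡ empty
      p₂ = T₂-vacant vac p₀ pA

    away-T₀ : Away T₀
    away-T₀ = (λ ()) , (λ ())

    away-T₂ : Away T₂
    away-T₂ = (λ ()) , (λ ())

    triangle-jump : ∀ {P Q} → IsPosition m P → SingleVacancy P i → IsPosition m Q →
                    ∀ j l → j ≢ l → Step m P (jumpM (tri i j) (tri i l)) Q →
                    Balanced P (jumpM (tri i j) (tri i l)) Q
    triangle-jump pos vac posQ zero             (suc zero)       _ = T₀→A pos vac
    triangle-jump pos vac posQ (suc zero)       (suc (suc zero)) _ = A→T₂ pos vac
    triangle-jump pos vac posQ (suc (suc zero)) (suc zero)       _ = T₂→A pos vac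
    triangle-jump pos vac posQ (suc zero)       zero             _ = A→T₀ pos vac
    triangle-jump pos vac posQ zero             (suc (suc zero)) _ = idle-jump pos posQ away-T₀ away-T₂
    triangle-jump pos vac posQ (suc (suc zero)) zero             _ = idle-jump pos posQ away-T₂ away-T₀
    triangle-jump pos vac posQ zero             zero             j≢l = ⊥-elim (j≢l refl)
    triangle-jump pos vac posQ (suc zero)       (suc zero)       j≢l = ⊥-elim (j≢l refl)
    triangle-jump pos vac posQ (suc (suc zero)) (suc (suc zero)) j≢l = ⊥-elim (j≢l refl)

    retarget : ∀ {P Q v w w′} → w ≡ w′ →
               (Step m P (jumpM v w′) Q → Balanced P (jumpM v w′) Q) →
               Step m P (jumpM v w) Q → Balanced P (jumpM v w) Q
    retarget refl balance = balance

    step-balanced : ∀ {P μ Q} → IsPosition m P → SingleVacancy P i → Step m P μ Q → Balanced P μ Q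
    step-balanced pos vac s@(swapS _ _ (tri→cyc k j) pv pw qv qw fr) with tri k j ≟ A
    ... | yes refl =
      by-pieces (swapM A B) pv pw refl refl qv qw (fr T₀ (λ ()) (λ ())) (fr T₂ (λ ()) (λ ())) refl (ℤ.+-identityʳ _)
    ... | no other =
      idle-balanced pos (step-position pos s) pv qw (other , (λ ()))
        ((λ ()) , λ e → other (partner-vertex-injective k j i (suc zero) e)) refl
    step-balanced pos vac s@(swapS _ _ (cyc→tri k j) pv pw qv qw fr) with tri k j ≟ A
    ... | yes refl =
      by-pieces (swapM B A) pw pv refl refl qw qv (fr T₀ (λ ()) (λ ())) (fr T₂ (λ ()) (λ ())) refl (ℤ.+-identityʳ _)
    ... | no other =
      idle-balanced pos (step-position pos s) pv qw
        ((λ ()) , λ e → other (partner-vertex-injective k j i (suc zero) e)) (other , (λ ())) refl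
    step-balanced pos vac s@(jumpS _ _ (inTri k j l j≢l) _ _ _ _ _) with k ≟F i
    ... | yes refl = triangle-jump pos vac (step-position pos s) j l j≢l s
    ... | no k≢i = idle-jump pos (step-position pos s) (elsewhere j) (elsewhere l) s
      where
      elsewhere : ∀ a → Away (tri k a)
      elsewhere a = (λ e → k≢i (proj₁ (tri-injective e))) , (λ ())
    step-balanced pos vac s@(jumpS _ _ (cycNext t) _ _ _ _ _)
      with t ≟F partnerIdx m i zero | t ≟F partnerIdx m i (suc zero)
    ... | yes refl | _ = retarget (cong cyc (next-partner₀ i)) (Bₘ→B pos vac) s
    ... | no _ | yes refl = retarget (cong cyc (next-partner₁ i)) (B→Bₚ pos vac) s
    ... | no t≢b₀ | no t≢b₁ =
      idle-jump pos (step-position pos s) ((λ ()) , λ e → t≢b₁ (cyc-injective e))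
        ((λ ()) , λ e → t≢b₀ (before-B (cyc-injective e))) s
      where
      before-B : nextF m t ≡ partnerIdx m i (suc zero) → t ≡ partnerIdx m i zero
      before-B e = trans (sym (prev-next t)) (trans (cong (prevF m) e) (prev-partner₁ i))
    step-balanced pos vac s@(jumpS _ _ (cycPrev t) _ _ _ _ _)
      with t ≟F partnerIdx m i (suc (suc zero)) | t ≟F partnerIdx m i (suc zero)
    ... | yes refl | _ = retarget (cong cyc (prev-partner₂ i)) (Bₚ→B pos vac) s
    ... | no _ | yes refl = retarget (cong cyc (prev-partner₁ i)) (B→Bₘ pos vac) s
    ... | no t≢b₂ | no t≢b₁ =
      idle-jump pos (step-position pos s) ((λ ()) , λ e → t≢b₁ (cyc-injective e))
        ((λ ()) , λ e → t≢b₂ (after-B (cyc-injective e))) s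
      where
      after-B : prevF m t ≡ partnerIdx m i (suc zero) → t ≡ partnerIdx m i (suc (suc zero))
      after-B e = trans (sym (next-prev t)) (trans (cong (nextF m) e) (next-partner₁ i))

    legal-balanced : ∀ {P σ R} → IsPosition m P → SingleVacancy P i → Legal m P σ R →
                     potential P +ℤ flowGap σ ≡ potential R
    legal-balanced pos vac done = ℤ.+-identityʳ _
    legal-balanced {P} {R = R} pos vac (step {Q = Q} {μ = μ} {σ = σ} s rest) = begin
      potential P +ℤ flowGap (μ ∷ σ)              ≡⟨ cong (potential P +ℤ_) (flowGap-cons μ σ) ⟩
      potential P +ℤ (flowGap [ μ ] +ℤ flowGap σ)  ≡⟨ ℤ.+-assoc (potential P) (flowGap [ μ ]) (flowGap σ) ⟨
      (potential P +ℤ flowGap [ μ ]) +ℤ flowGap σ  ≡⟨ cong (_+ℤ flowGap σ) (Balanced.change (step-balanced pos vac s)) ⟩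
      potential Q +ℤ flowGap σ                    ≡⟨ legal-balanced (step-position pos s) (step-vacancy s vac) rest ⟩
      potential R                                 ∎
      where open ≡-Reasoning

    initial-vacancy : ∀ {P t} → IsPosition m P →
      (∀ v → (P v ≡ switch → InitialSwitch m v) × (InitialSwitch m v → P v ≡ switch)) →
      P (cyc t) ≡ chip → SingleVacancy P i
    initial-vacancy {P} pos initial chip-on-cycle = vacancy-at (suc zero) A-vacant only-A
      where
      A-not-initial : ¬ InitialSwitch m A
      A-not-initial ()
      A-off-cycle : ∀ {t} → A ≢ cyc t
      A-off-cycle ()
      A-vacant : P A ≡ empty
      A-vacant = vacant (λ s → A-not-initial (proj₁ (initial A) s))
                        (λ c → A-off-cycle (chip-unique pos c chip-on-cycle))
      only-A : ∀ l → P (tri i l) ≡ empty → l ≡ suc zero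
      only-A zero             e = ⊥-elim (≢-by (proj₂ (initial T₀) (sw1 i)) (λ ()) e)
      only-A (suc zero)       _ = refl
      only-A (suc (suc zero)) e = ⊥-elim (≢-by (proj₂ (initial T₂) (sw3 i)) (λ ()) e)

    potential-cong : ∀ {P R} → (∀ v → R v ≡ P v) → potential R ≡ potential P
    potential-cong same rewrite same A | same B | same T₀ | same T₂ = refl

    -- The flow through (0, 3i+2) in the statement is the flow through B = (0, 3i+1+1).
    flow-through-B : ∀ σ → twiceFlowCyc m σ (cycIdx m (3 * toℕ i + 2)) ≡ twiceFlowAt m σ Bₘ B Bₚ
    flow-through-B σ =
      trans (cong (twiceFlowCyc m σ) (cong (_mod (3 * m)) (sym (+-assoc (3 * toℕ i) 1 1))))
            (cong₂ (λ a c → twiceFlowAt m σ (cyc a) B (cyc c)) (prev-partner₁ i) (next-partner₁ i))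

lemma1 : ∀ (m : ℕ) .{{_ : NonZero m}} (P : Occ m) →
         IsPosition m P →
         (∀ v → (P v ≡ switch → InitialSwitch m v) × (InitialSwitch m v → P v ≡ switch)) →
         (∃ λ t → P (cyc t) ≡ chip) →
         ∀ (σ : List (Move m)) (R : Occ m) →
         Legal m P σ R →
         (∀ v → R v ≡ P v) →
         ∀ (i : Fin m) →
         twiceFlowTri m σ i (suc zero) ≡ twiceFlowCyc m σ (cycIdx m (3 * toℕ i + 2))
lemma1 m P pos initial (_ , chip-on-cycle) σ R legal R≡P i = begin
  twiceFlowTri m σ i (suc zero)                  ≡⟨⟩
  twiceFlowAt m σ T₀ A T₂                        ≡⟨ ℤ.i-j≡0⇒i≡j _ _ no-gap ⟩
  twiceFlowAt m σ Bₘ B Bₚ                        ≡⟨ flow-through-B σ ⟨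
  twiceFlowCyc m σ (cycIdx m (3 * toℕ i + 2))    ∎
  where
  open Gadget m i
  open ≡-Reasoning
  no-gap : flowGap σ ≡ 0ℤ
  no-gap = +-no-effect (potential P) (flowGap σ)
             (trans (legal-balanced pos (initial-vacancy pos initial chip-on-cycle) legal)
                    (potential-cong R≡P))
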